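{- Let $\mathcal{F}$ be a hereditary graph class and $\ell\ge 5$. If $G$ is a dynamically $\ell$-minimal graph in $\mathcal{F}$, then no two vertices of degree $2$ are adjacent in $G$.
   Context: All graphs are simple and finite. A graph class is hereditary if it is closed under taking subgraphs. A proper coloring is dynamic if every vertex of degree at least two has at least two distinct colors among its neighbors. $G$ is dynamically $\ell$-choosable if for every list assignment $L$ with $|L(v)|=\ell$ for all $v$ there is a dynamic coloring $c$ with $c(v)\in L(v)$ for all $v$. $G$ is dynamically $\ell$-minimal in $\mathcal{F}$ if $G\in\mathcal{F}$, $G$ is not dynamically $\ell$-choosable, and every $H\in\mathcal{F}$ with $|V(H)|+|E(H)|<|V(G)|+|E(G)|$ is dynamically $\ell$-choosable. -}

module Defs where

open import Data.Nat using (ℕ; zero; suc; _+_; _<_; _≤_; _<ᵇ_)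
open import Data.Bool using (Bool; true; false; _∧_; if_then_else_)
open import Data.Fin using (Fin; toℕ)
open import Data.List using (List; length; map; allFin)
open import Data.Nat.ListAction using (sum)
open import Data.List.Membership.Propositional using (_∈_)
open import Data.List.Relation.Unary.Unique.Propositional using (Unique)
open import Data.Product using (Σ; ∃; _×_; _,_)
open import Relation.Binary.PropositionalEquality using (_≡_; _≢_)
open import Relation.Nullary using (¬_)
open import Function.Definitions using (Injective)


record Graph : Set where
  field
    order : ℕ
    adj   : Fin order → Fin order → Bool
    sym   : ∀ u v → adj u v ≡ adj v u
    irrefl : ∀ u → adj u u ≡ false
open Graph public

ind : Bool → ℕ
ind b = if b then 1 else 0

degree : (G : Graph) → Fin (order G) → ℕ
degree G u = sum (map (λ v → ind (adj G u v)) (allFin (order G)))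

edgeCount : Graph → ℕ
edgeCount G = sum (map (λ u → sum (map (λ v → ind (adj G u v ∧ (toℕ u <ᵇ toℕ v)))
                                        (allFin (order G))))
                       (allFin (order G)))

size : Graph → ℕ
size G = order G + edgeCount G

_⊆G_ : Graph → Graph → Set
H ⊆G G = Σ (Fin (order H) → Fin (order G)) λ f →
           Injective _≡_ _≡_ f ×
           (∀ u v → adj H u v ≡ true → adj G (f u) (f v) ≡ true)

GraphClass : Set₁
GraphClass = Graph → Set

Hereditary : GraphClass → Set
Hereditary 𝓕 = ∀ G H → H ⊆G G → 𝓕 G → 𝓕 H

Proper : (G : Graph) → (Fin (order G) → ℕ) → Set
Proper G c = ∀ u v → adj G u v ≡ true → c u ≢ c v

Dynamic : (G : Graph) → (Fin (order G) → ℕ) → Set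
Dynamic G c = Proper G c ×
  (∀ u → 2 ≤ degree G u →
     Σ (Fin (order G)) λ v → Σ (Fin (order G)) λ w →
       adj G u v ≡ true × adj G u w ≡ true × c v ≢ c w)

ListAssignment : ℕ → Graph → Set
ListAssignment ℓ G = Σ (Fin (order G) → List ℕ) λ L →
  ∀ v → Unique (L v) × length (L v) ≡ ℓ

DynChoosable : ℕ → Graph → Set
DynChoosable ℓ G = ∀ (A : ListAssignment ℓ G) →
  let L = Data.Product.proj₁ A in
  Σ (Fin (order G) → ℕ) λ c → Dynamic G c × (∀ v → c v ∈ L v)

DynMinimal : ℕ → GraphClass → Graph → Set
DynMinimal ℓ 𝓕 G = 𝓕 G × ¬ DynChoosable ℓ G ×
  (∀ H → 𝓕 H → size H < size G → DynChoosable ℓ H)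

module Submission where

-- Let u ~ v have degree two, x the other neighbour of u and y the other
-- neighbour of v.  The graph H = G − uv is a subgraph of G, hence in 𝓕, and
-- smaller than G, so minimality makes H dynamically ℓ-choosable.  We show
-- that this forces G to be dynamically ℓ-choosable (lemma Reattach.extend),
-- contradicting minimality.  Given lists L and a dynamic L-colouring c of H,
-- only u and v are recoloured: u gets a colour of L(u) avoiding c(x), c(y)
-- and one "spare" colour that keeps x seeing two colours; then v gets a
-- colour of L(v) avoiding c(x), c(y), the new colour of u and the spare
-- colour of y.  At most four colours are forbidden, so ℓ ≥ 5 suffices.

open import Defs hiding (sym)
open import Data.Nat using (ℕ; _≤_)
open import Data.Fin using (Fin)
open import Data.Bool using (true)
open import Data.Empty using (⊥)
open import Relation.Binary.PropositionalEquality using (_≡_)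

open import Data.Nat using (suc; _<_; _<ᵇ_; z≤n; s≤s⁻¹; z<s; s<s; _≤?_)
  renaming (_≟_ to _≟ℕ_)
open import Data.Nat.Properties
  using (≤-refl; <-≤-trans; +-mono-≤; +-mono-<-≤; +-mono-≤-<; +-monoʳ-<; <-cmp; <⇒<ᵇ)
open import Data.Nat.ListAction using (sum)
open import Data.Bool using (Bool; false; _∧_; _∨_; not; if_then_else_)
  renaming (_≟_ to _≟ᵇ_)
open import Data.Bool.Properties using (∧-comm; ∨-comm; ∧-identityʳ; ∧-zeroʳ; T-≡)
open import Data.Fin using (toℕ; _≟_)
open import Data.Fin.Properties using (toℕ-injective)
open import Data.List using (List; []; _∷_; map; length; allFin; filter)
open import Data.List.Properties using (map-cong; filter-notAll)
open import Data.List.Relation.Unary.All as All using ([]; _∷_)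
open import Data.List.Relation.Unary.Any as Any using (here; there)
open import Data.List.Relation.Unary.AllPairs using (_∷_)
open import Data.List.Membership.Propositional using (_∈_; _∉_)
open import Data.List.Membership.Propositional.Properties
  using (∈-filter⁺; ∈-filter⁻; ∈-allFin)
open import Data.List.Relation.Unary.Unique.Propositional using (Unique)
open import Data.List.Relation.Unary.Unique.Propositional.Properties using (allFin⁺; filter⁺)
open import Data.Product using (Σ; _×_; _,_; proj₁; proj₂)
open import Function using (_∘_)
open import Function.Bundles using (Equivalence)
open import Relation.Binary using (DecidableEquality; tri<; tri≈; tri>)
open import Relation.Binary.PropositionalEquality
  using (_≢_; refl; sym; trans; cong; cong₂; subst; ≢-sym)
open import Relation.Nullary using (Dec; yes; no; ¬?; contradiction)
open import Relation.Nullary.Decidable using (⌊_⌋)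

≢-resp : {A : Set} {a a′ b b′ : A} → a ≡ a′ → b ≡ b′ → a′ ≢ b′ → a ≢ b
≢-resp refl refl a≢b = a≢b

module _ {A : Set} {f g : A → ℕ} (f≤g : ∀ a → f a ≤ g a) where

  sum-mono-≤ : (xs : List A) → sum (map f xs) ≤ sum (map g xs)
  sum-mono-≤ []       = z≤n
  sum-mono-≤ (x ∷ xs) = +-mono-≤ (f≤g x) (sum-mono-≤ xs)

  sum-mono-< : {xs : List A} {a : A} → a ∈ xs → f a < g a →
               sum (map f xs) < sum (map g xs)
  sum-mono-< {x ∷ xs} (here refl)  fa<ga = +-mono-<-≤ fa<ga (sum-mono-≤ xs)
  sum-mono-< {x ∷ xs} (there a∈xs) fa<ga = +-mono-≤-< (f≤g x) (sum-mono-< a∈xs fa<ga)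

sum-ind≡length-filter : {A : Set} (p : A → Bool) (xs : List A) →
  sum (map (λ a → ind (p a)) xs) ≡ length (filter (λ a → p a ≟ᵇ true) xs)
sum-ind≡length-filter p []       = refl
sum-ind≡length-filter p (x ∷ xs) with p x
... | true  = cong suc (sum-ind≡length-filter p xs)
... | false = sum-ind≡length-filter p xs

-- Pigeonhole: a duplicate-free list longer than bs has a member outside bs.
-- This is how a colour avoiding the forbidden ones is found in a list.
module _ {A : Set} (_≟A_ : DecidableEquality A) where
  open import Data.List.Membership.DecPropositional _≟A_ using (_∈?_)

  fresh : {xs : List A} → Unique xs → (bs : List A) → length bs < length xs →
          Σ A λ a → a ∈ xs × a ∉ bs
  fresh {x ∷ xs} (x∉xs ∷ xs-unique) bs |bs|<|xs| with x ∈? bs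
  ... | no x∉bs = x , here refl , x∉bs
  ... | yes x∈bs = lift (fresh xs-unique rest shorter)
    where
      -- bs with every copy of x removed; it is shorter because x ∈ bs
      rest : List A
      rest = filter (λ b → ¬? (b ≟A x)) bs

      shorter : length rest < length xs
      shorter = <-≤-trans (filter-notAll _ bs (Any.map (λ x≡b b≢x → b≢x (sym x≡b)) x∈bs))
                          (s≤s⁻¹ |bs|<|xs|)

      lift : Σ A (λ a → a ∈ xs × a ∉ rest) → Σ A λ a → a ∈ x ∷ xs × a ∉ bs
      lift (a , a∈xs , a∉rest) = a , there a∈xs , λ a∈bs →
        a∉rest (∈-filter⁺ _ a∈bs (λ a≡x → All.lookup x∉xs a∈xs (sym a≡x)))

partner : {A : Set} {xs : List A} {v : A} → Unique xs → length xs ≡ 2 → v ∈ xs →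
          Σ A λ x → x ∈ xs × x ≢ v × (∀ z → z ∈ xs → z ≢ v → z ≡ x)
partner {xs = a ∷ b ∷ []} ((a≢b ∷ []) ∷ _) refl (here refl) =
  b , there (here refl) , ≢-sym a≢b , only-b
  where
    only-b : ∀ z → z ∈ a ∷ b ∷ [] → z ≢ a → z ≡ b
    only-b z (here z≡a)         z≢a = contradiction z≡a z≢a
    only-b z (there (here z≡b)) _   = z≡b
partner {xs = a ∷ b ∷ []} ((a≢b ∷ []) ∷ _) refl (there (here refl)) =
  a , here refl , a≢b , only-a
  where
    only-a : ∀ z → z ∈ a ∷ b ∷ [] → z ≢ b → z ≡ a
    only-a z (here z≡a)         _   = z≡a
    only-a z (there (here z≡b)) z≢b = contradiction z≡b z≢b

module _ (G : Graph) where

  adj-sym : ∀ {a b} → adj G a b ≡ true → adj G b a ≡ true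
  adj-sym {a} {b} a~b = trans (Graph.sym G b a) a~b

  adj⇒≢ : ∀ {a b} → adj G a b ≡ true → a ≢ b
  adj⇒≢ {a} a~a refl with () ← trans (sym (irrefl G a)) a~a

  adjacent? : ∀ a b → Dec (adj G a b ≡ true)
  adjacent? a b = adj G a b ≟ᵇ true

  neighbours : Fin (order G) → List (Fin (order G))
  neighbours a = filter (adjacent? a) (allFin (order G))

  degree≡length-neighbours : ∀ a → degree G a ≡ length (neighbours a)
  degree≡length-neighbours a = sum-ind≡length-filter (adj G a) (allFin (order G))

  record OtherNeighbour (u v : Fin (order G)) : Set where
    field
      other    : Fin (order G)
      adjacent : adj G u other ≡ true
      distinct : other ≢ v
      unique   : ∀ z → adj G u z ≡ true → z ≢ v → z ≡ other

  -- A degree-two vertex u adjacent to v has exactly one other neighbour,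
  -- since its neighbour list is duplicate-free of length two.
  other-neighbour : ∀ {u v} → degree G u ≡ 2 → adj G u v ≡ true → OtherNeighbour u v
  other-neighbour {u} {v} deg-u u~v
    with x , x∈N , x≢v , only-x ← partner (filter⁺ (adjacent? u) (allFin⁺ (order G)))
                                         (trans (sym (degree≡length-neighbours u)) deg-u)
                                         (∈-filter⁺ (adjacent? u) (∈-allFin v) u~v)
    = record { other    = x
             ; adjacent = proj₂ (∈-filter⁻ (adjacent? u) {xs = allFin (order G)} x∈N)
             ; distinct = x≢v
             ; unique   = λ z u~z → only-x z (∈-filter⁺ (adjacent? u) (∈-allFin z) u~z) }

-- Counting the related pairs a < b of a Boolean relation on Fin n;
-- edgeCount G is by definition pairCount (order G) (adj G).
pairCount : (n : ℕ) → (Fin n → Fin n → Bool) → ℕ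
pairCount n R =
  sum (map (λ a → sum (map (λ b → ind (R a b ∧ (toℕ a <ᵇ toℕ b))) (allFin n))) (allFin n))

pairCount-< : ∀ {n} {R S : Fin n → Fin n → Bool} →
  (∀ a b → R a b ≡ true → S a b ≡ true) →
  ∀ {a b} → R a b ≡ false → S a b ≡ true → toℕ a < toℕ b →
  pairCount n R < pairCount n S
pairCount-< {n} {R} {S} R⊆S {a} {b} ¬Rab Sab a<b =
  sum-mono-< row-≤ (∈-allFin a) (sum-mono-< (entry-≤ a) (∈-allFin b) entry-<)
  where
    entry-≤ : ∀ a b → ind (R a b ∧ (toℕ a <ᵇ toℕ b)) ≤ ind (S a b ∧ (toℕ a <ᵇ toℕ b))
    entry-≤ a b with R a b | R⊆S a b
    ... | true  | R⇒S rewrite R⇒S refl = ≤-refl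
    ... | false | _ = z≤n

    row-≤ : ∀ a → sum (map (λ b → ind (R a b ∧ (toℕ a <ᵇ toℕ b))) (allFin n))
                ≤ sum (map (λ b → ind (S a b ∧ (toℕ a <ᵇ toℕ b))) (allFin n))
    row-≤ a = sum-mono-≤ (entry-≤ a) (allFin n)

    entry-< : ind (R a b ∧ (toℕ a <ᵇ toℕ b)) < ind (S a b ∧ (toℕ a <ᵇ toℕ b))
    entry-< rewrite ¬Rab | Sab | Equivalence.to T-≡ (<⇒<ᵇ a<b) = z<s

joins : ∀ {n} (u v a b : Fin n) → Bool
joins u v a b = (⌊ a ≟ u ⌋ ∧ ⌊ b ≟ v ⌋) ∨ (⌊ a ≟ v ⌋ ∧ ⌊ b ≟ u ⌋)

joins-sym : ∀ {n} (u v a b : Fin n) → joins u v a b ≡ joins u v b a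
joins-sym u v a b = trans (∨-comm (⌊ a ≟ u ⌋ ∧ ⌊ b ≟ v ⌋) _)
                          (cong₂ _∨_ (∧-comm ⌊ a ≟ v ⌋ _) (∧-comm ⌊ a ≟ u ⌋ _))

deleteEdge : (G : Graph) → Fin (order G) → Fin (order G) → Graph
deleteEdge G u v = record
  { order  = order G
  ; adj    = λ a b → adj G a b ∧ not (joins u v a b)
  ; sym    = λ a b → cong₂ (λ p q → p ∧ not q) (Graph.sym G a b) (joins-sym u v a b)
  ; irrefl = λ a → cong (λ p → p ∧ not (joins u v a a)) (irrefl G a)
  }

module _ (G : Graph) (u v : Fin (order G)) where
  private
    H = deleteEdge G u v

  deleteEdge-⊆ : ∀ {a b} → adj H a b ≡ true → adj G a b ≡ true
  deleteEdge-⊆ {a} {b} a~b with adj G a b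
  ... | true  = refl
  ... | false = a~b

  deleteEdge-subgraph : H ⊆G G
  deleteEdge-subgraph = (λ a → a) , (λ a≡b → a≡b) , (λ a b → deleteEdge-⊆)

  deleteEdge-away : ∀ {a} b → a ≢ u → a ≢ v → adj H a b ≡ adj G a b
  deleteEdge-away {a} b a≢u a≢v with a ≟ u | a ≟ v
  ... | yes a≡u | _       = contradiction a≡u a≢u
  ... | no _    | yes a≡v = contradiction a≡v a≢v
  ... | no _    | no _    = ∧-identityʳ (adj G a b)

  deleteEdge-degree : ∀ {a} → a ≢ u → a ≢ v → degree H a ≡ degree G a
  deleteEdge-degree a≢u a≢v =
    cong sum (map-cong (λ b → cong ind (deleteEdge-away b a≢u a≢v)) (allFin (order G)))

  deleteEdge-removes : adj H u v ≡ false
  deleteEdge-removes with u ≟ u | v ≟ v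
  ... | yes _   | yes _   = ∧-zeroʳ (adj G u v)
  ... | no u≢u  | _       = contradiction refl u≢u
  ... | yes _   | no v≢v  = contradiction refl v≢v

  deleteEdge-smaller : adj G u v ≡ true → size H < size G
  deleteEdge-smaller u~v = +-monoʳ-< (order G) fewer-edges
    where
      fewer-edges : edgeCount H < edgeCount G
      fewer-edges with <-cmp (toℕ u) (toℕ v)
      ... | tri< u<v _ _ = pairCount-< (λ a b → deleteEdge-⊆) deleteEdge-removes u~v u<v
      ... | tri≈ _ u≡v _ = contradiction (toℕ-injective u≡v) (adj⇒≢ G u~v)
      ... | tri> _ _ v<u = pairCount-< (λ a b → deleteEdge-⊆)
                             (trans (Graph.sym H v u) deleteEdge-removes) (adj-sym G u~v) v<u

module Reattach (G : Graph) {u v : Fin (order G)} (u~v : adj G u v ≡ true)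
                (deg-u : degree G u ≡ 2) (deg-v : degree G v ≡ 2) where

  private
    V = Fin (order G)
    H = deleteEdge G u v

  open OtherNeighbour (other-neighbour G deg-u u~v)
    renaming (other to x; adjacent to u~x; distinct to x≢v; unique to only-x)
  open OtherNeighbour (other-neighbour G deg-v (adj-sym G u~v))
    renaming (other to y; adjacent to v~y; distinct to y≢u; unique to only-y)

  u≢v : u ≢ v
  u≢v = adj⇒≢ G u~v

  -- A vertex is fixed if it is neither u nor v; only u and v get recoloured.
  Fixed : V → Set
  Fixed z = z ≢ u × z ≢ v

  x-fixed : Fixed x
  x-fixed = (λ x≡u → adj⇒≢ G u~x (sym x≡u)) , x≢v

  y-fixed : Fixed y
  y-fixed = y≢u , (λ y≡v → adj⇒≢ G v~y (sym y≡v))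

  towards-u : ∀ {w p} → w ≢ v → adj H w p ≡ true → p ≡ u → w ≡ x
  towards-u w≢v w~p refl = only-x _ (adj-sym G (deleteEdge-⊆ G u v w~p)) w≢v

  towards-v : ∀ {w p} → w ≢ u → adj H w p ≡ true → p ≡ v → w ≡ y
  towards-v w≢u w~p refl = only-y _ (adj-sym G (deleteEdge-⊆ G u v w~p)) w≢u

  data Position (z : V) : Set where
    at-u  : z ≡ u → Position z
    at-v  : z ≡ v → Position z
    fixed : Fixed z → Position z

  position : ∀ z → Position z
  position z with z ≟ u | z ≟ v
  ... | yes z≡u | _       = at-u z≡u
  ... | no _    | yes z≡v = at-v z≡v
  ... | no z≢u  | no z≢v  = fixed (z≢u , z≢v)

  module Recolour (c : V → ℕ) (a b : ℕ) where

    c′ : V → ℕ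
    c′ z = if ⌊ z ≟ u ⌋ then a else if ⌊ z ≟ v ⌋ then b else c z

    c′-at-u : ∀ {z} → z ≡ u → c′ z ≡ a
    c′-at-u {z} z≡u with z ≟ u
    ... | yes _   = refl
    ... | no z≢u  = contradiction z≡u z≢u

    c′-at-v : ∀ {z} → z ≡ v → c′ z ≡ b
    c′-at-v {z} z≡v with z ≟ u | z ≟ v
    ... | yes z≡u | _      = contradiction (trans (sym z≡u) z≡v) u≢v
    ... | no _    | yes _  = refl
    ... | no _    | no z≢v = contradiction z≡v z≢v

    c′-fixed : ∀ {z} → Fixed z → c′ z ≡ c z
    c′-fixed {z} (z≢u , z≢v) with z ≟ u | z ≟ v
    ... | yes z≡u | _       = contradiction z≡u z≢u
    ... | no _    | yes z≡v = contradiction z≡v z≢v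
    ... | no _    | no _    = refl

    c′-∈ : (L : V → List ℕ) → (∀ z → c z ∈ L z) → a ∈ L u → b ∈ L v → ∀ z → c′ z ∈ L z
    c′-∈ L c∈L a∈L b∈L z with position z
    ... | at-u refl  = subst (_∈ L u) (sym (c′-at-u refl)) a∈L
    ... | at-v refl  = subst (_∈ L v) (sym (c′-at-v refl)) b∈L
    ... | fixed z-fixed = subst (_∈ L z) (sym (c′-fixed z-fixed)) (c∈L z)

    c′-distinct : a ≢ b → ∀ {p q} → p ≢ q →
      (Fixed q → c′ p ≢ c q) → (Fixed p → c p ≢ c′ q) → c′ p ≢ c′ q
    c′-distinct a≢b {p} {q} p≢q keep-q keep-p with position p | position q
    ... | _         | fixed q-fixed = ≢-resp refl (c′-fixed q-fixed) (keep-q q-fixed)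
    ... | fixed p-fixed | _         = ≢-resp (c′-fixed p-fixed) refl (keep-p p-fixed)
    ... | at-u p≡u  | at-u q≡u      = contradiction (trans p≡u (sym q≡u)) p≢q
    ... | at-u p≡u  | at-v q≡v      = ≢-resp (c′-at-u p≡u) (c′-at-v q≡v) a≢b
    ... | at-v p≡v  | at-u q≡u      = ≢-resp (c′-at-v p≡v) (c′-at-u q≡u) (≢-sym a≢b)
    ... | at-v p≡v  | at-v q≡v      = contradiction (trans p≡v (sym q≡v)) p≢q

  module _ (c : V → ℕ) (c-dynamic : Dynamic H c) where

    witnesses : V → V × V
    witnesses w with 2 ≤? degree H w
    ... | yes d = proj₁ (proj₂ c-dynamic w d) , proj₁ (proj₂ (proj₂ c-dynamic w d))
    ... | no _  = w , w

    witnesses-sound : ∀ w → 2 ≤ degree H w →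
      adj H w (proj₁ (witnesses w)) ≡ true × adj H w (proj₂ (witnesses w)) ≡ true ×
      c (proj₁ (witnesses w)) ≢ c (proj₂ (witnesses w))
    witnesses-sound w d with 2 ≤? degree H w
    ... | yes d′ = proj₂ (proj₂ (proj₂ c-dynamic w d′))
    ... | no ¬d  = contradiction d ¬d

    -- spare t w: the colour of the witness of w other than t.  Avoiding it
    -- at t keeps the witnesses of w differently coloured.
    spare : V → V → ℕ
    spare t w = if ⌊ proj₁ (witnesses w) ≟ t ⌋ then c (proj₂ (witnesses w))
                                               else c (proj₁ (witnesses w))

    spare-first : ∀ {t w} → proj₁ (witnesses w) ≡ t → spare t w ≡ c (proj₂ (witnesses w))
    spare-first {t} {w} p≡t with proj₁ (witnesses w) ≟ t
    ... | yes _  = refl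
    ... | no p≢t = contradiction p≡t p≢t

    spare-second : ∀ {t w} → proj₁ (witnesses w) ≢ t → spare t w ≡ c (proj₁ (witnesses w))
    spare-second {t} {w} p≢t with proj₁ (witnesses w) ≟ t
    ... | yes p≡t = contradiction p≡t p≢t
    ... | no _    = refl

    module _ {a b : ℕ} (a-avoids : a ∉ c x ∷ c y ∷ spare u x ∷ [])
                       (b-avoids : b ∉ c x ∷ c y ∷ a ∷ spare v y ∷ []) where
      open Recolour c a b

      a≢cx : a ≢ c x
      a≢cx = a-avoids ∘ here
      a≢cy : a ≢ c y
      a≢cy = a-avoids ∘ there ∘ here
      a≢spare : a ≢ spare u x
      a≢spare = a-avoids ∘ there ∘ there ∘ here
      b≢cx : b ≢ c x
      b≢cx = b-avoids ∘ here
      b≢cy : b ≢ c y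
      b≢cy = b-avoids ∘ there ∘ here
      a≢b : a ≢ b
      a≢b = ≢-sym (b-avoids ∘ there ∘ there ∘ here)
      b≢spare : b ≢ spare v y
      b≢spare = b-avoids ∘ there ∘ there ∘ there ∘ here

      -- An edge s t with t fixed is properly coloured: either s is fixed and
      -- st is an edge of H, or st is one of the edges ux, vy.
      edge-to-fixed : ∀ {s t} → adj G s t ≡ true → Fixed t → c′ s ≢ c t
      edge-to-fixed {s} {t} s~t (t≢u , t≢v) with position s
      ... | at-u refl = ≢-resp (c′-at-u refl) (cong c (only-x t s~t t≢v)) a≢cx
      ... | at-v refl = ≢-resp (c′-at-v refl) (cong c (only-y t s~t t≢u)) b≢cy
      ... | fixed (s≢u , s≢v) =
        ≢-resp (c′-fixed (s≢u , s≢v)) refl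
               (proj₁ c-dynamic s t (trans (deleteEdge-away G u v t s≢u s≢v) s~t))

      c′-proper : Proper G c′
      c′-proper s t s~t =
        c′-distinct a≢b (adj⇒≢ G s~t) (edge-to-fixed s~t)
                    (λ s-fixed → ≢-sym (edge-to-fixed (adj-sym G s~t) s-fixed))

      -- A fixed vertex w keeps its two witnesses differently coloured: a
      -- recoloured witness is u (so w = x) or v (so w = y), and a resp. b
      -- avoids the colour of the other witness, which is the spare colour.
      witnesses-survive : ∀ {w} → Fixed w → 2 ≤ degree H w →
        c′ (proj₁ (witnesses w)) ≢ c′ (proj₂ (witnesses w))
      witnesses-survive {w} (w≢u , w≢v) d =
        c′-distinct a≢b (λ p≡q → c-p≢c-q (cong c p≡q)) keep-second keep-first
        where
          p q : V
          p = proj₁ (witnesses w)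
          q = proj₂ (witnesses w)
          w~p : adj H w p ≡ true
          w~p = proj₁ (witnesses-sound w d)
          w~q : adj H w q ≡ true
          w~q = proj₁ (proj₂ (witnesses-sound w d))
          c-p≢c-q : c p ≢ c q
          c-p≢c-q = proj₂ (proj₂ (witnesses-sound w d))

          keep-second : Fixed q → c′ p ≢ c q
          keep-second _ with position p
          ... | at-u p≡u = ≢-resp (c′-at-u p≡u)
                  (trans (sym (spare-first p≡u)) (cong (spare u) (towards-u w≢v w~p p≡u))) a≢spare
          ... | at-v p≡v = ≢-resp (c′-at-v p≡v)
                  (trans (sym (spare-first p≡v)) (cong (spare v) (towards-v w≢u w~p p≡v))) b≢spare
          ... | fixed p-fixed = ≢-resp (c′-fixed p-fixed) refl c-p≢c-q

          keep-first : Fixed p → c p ≢ c′ q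
          keep-first (p≢u , p≢v) with position q
          ... | at-u q≡u = ≢-sym (≢-resp (c′-at-u q≡u)
                  (trans (sym (spare-second p≢u)) (cong (spare u) (towards-u w≢v w~q q≡u))) a≢spare)
          ... | at-v q≡v = ≢-sym (≢-resp (c′-at-v q≡v)
                  (trans (sym (spare-second p≢v)) (cong (spare v) (towards-v w≢u w~q q≡v))) b≢spare)
          ... | fixed q-fixed = ≢-resp refl (c′-fixed q-fixed) c-p≢c-q

      -- Every vertex of degree at least two sees two colours under c′:
      -- u sees x and v, v sees y and u, and a fixed vertex has the same
      -- degree in H and G and uses its witnesses.
      c′-dynamic : Dynamic G c′
      c′-dynamic = c′-proper , sees-two
        where
          sees-two : ∀ w → 2 ≤ degree G w → Σ V λ p → Σ V λ q →
                     adj G w p ≡ true × adj G w q ≡ true × c′ p ≢ c′ q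
          sees-two w d with position w
          ... | at-u refl = x , v , u~x , u~v ,
                ≢-resp (c′-fixed x-fixed) (c′-at-v refl) (≢-sym b≢cx)
          ... | at-v refl = y , u , v~y , adj-sym G u~v ,
                ≢-resp (c′-fixed y-fixed) (c′-at-u refl) (≢-sym a≢cy)
          ... | fixed (w≢u , w≢v) =
                proj₁ (witnesses w) , proj₂ (witnesses w) ,
                deleteEdge-⊆ G u v (proj₁ (witnesses-sound w dH)) ,
                deleteEdge-⊆ G u v (proj₁ (proj₂ (witnesses-sound w dH))) ,
                witnesses-survive (w≢u , w≢v) dH
            where
              dH : 2 ≤ degree H w
              dH = subst (2 ≤_) (sym (deleteEdge-degree G u v w≢u w≢v)) d

  long : ∀ {ℓ} → 5 ≤ ℓ → ((L , L-ok) : ListAssignment ℓ G) → ∀ z {k} → k < 5 → k < length (L z)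
  long 5≤ℓ (L , L-ok) z k<5 = <-≤-trans k<5 (subst (5 ≤_) (sym (proj₂ (L-ok z))) 5≤ℓ)

  extend : ∀ {ℓ} → 5 ≤ ℓ → DynChoosable ℓ H → DynChoosable ℓ G
  extend {ℓ} 5≤ℓ H-choosable (L , L-ok)
    with c , c-dynamic , c∈L ← H-choosable (L , L-ok)
    with a , a∈L , a-avoids ← fresh _≟ℕ_ (proj₁ (L-ok u)) (c x ∷ c y ∷ spare c c-dynamic u x ∷ [])
                                        (long 5≤ℓ (L , L-ok) u (s<s (s<s (s<s z<s))))
    with b , b∈L , b-avoids ← fresh _≟ℕ_ (proj₁ (L-ok v)) (c x ∷ c y ∷ a ∷ spare c c-dynamic v y ∷ [])
                                        (long 5≤ℓ (L , L-ok) v (s<s (s<s (s<s (s<s z<s)))))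
    = Recolour.c′ c a b ,
      c′-dynamic c c-dynamic a-avoids b-avoids ,
      Recolour.c′-∈ c a b L c∈L a∈L b∈L

proposition2 : (𝓕 : GraphClass) → Hereditary 𝓕 → (ℓ : ℕ) → 5 ≤ ℓ →
    (G : Graph) → DynMinimal ℓ 𝓕 G →
    (u v : Fin (order G)) → adj G u v ≡ true →
    degree G u ≡ 2 → degree G v ≡ 2 → ⊥
proposition2 𝓕 hereditary ℓ 5≤ℓ G (G∈𝓕 , G-not-choosable , smaller-choosable) u v u~v deg-u deg-v =
  G-not-choosable (Reattach.extend G u~v deg-u deg-v 5≤ℓ H-choosable)
  where
    H : Graph
    H = deleteEdge G u v

    H-choosable : DynChoosable ℓ H
    H-choosable = smaller-choosable H (hereditary G H (deleteEdge-subgraph G u v) G∈𝓕)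
                                      (deleteEdge-smaller G u v u~v)
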